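{- Let $\Sigma$ be a finite alphabet with $|\Sigma|\ge 2$, $k\ge 2$, let $M$ be a minimum decycling set of $D_k$ and let $f\in\Sigma^{k-1}$ with $\mathrm{lc}(f)\subseteq M$. Then $fM=(M\setminus \mathrm{lc}(f))\cup\mathrm{rc}(f)$ is also a minimum decycling set of $D_k$.
   Context: The de Bruijn graph $D_k$ has vertex set $\Sigma^k$ and a directed edge $u\to v$ whenever the length-$(k-1)$ suffix of $u$ equals the length-$(k-1)$ prefix of $v$. A set $M\subseteq\Sigma^k$ is decycling if $D_k\setminus M$ has no directed cycle; a minimum decycling set (MDS) is a decycling set of minimum cardinality. For $f\in\Sigma^{k-1}$, $\mathrm{lc}(f)=\{af:a\in\Sigma\}$ and $\mathrm{rc}(f)=\{fa:a\in\Sigma\}$. The operation $M\mapsto fM$ (valid when $\mathrm{lc}(f)\subseteq M$) is called an F-move. -}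

module Defs where

open import Data.Nat using (ℕ; zero; suc; _≤_)
open import Data.Fin using (Fin)
open import Data.Fin.Properties using () renaming (_≟_ to _≟ᶠ_)
open import Data.Bool using (Bool; _∧_; _∨_; not; T)
open import Data.Bool.Properties using (T?)
open import Data.Vec using (Vec; []; _∷_; tail; init)
open import Data.Vec.Properties using (≡-dec)
open import Data.List using (List; [_]; concatMap; map; filter; length)
open import Data.List using () renaming (allFin to allFinL)
open import Data.Product using (_×_)
open import Relation.Nullary using (¬_; does)
open import Relation.Binary.PropositionalEquality using (_≡_)
open import Relation.Binary.Definitions using (DecidableEquality)
open import Relation.Binary.Construct.Closure.Transitive using (TransClosure)

Word : ℕ → ℕ → Set
Word q k = Vec (Fin q) k

WordSet : ℕ → ℕ → Set
WordSet q k = Word q k → Bool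

_∈ˢ_ : ∀ {q k} → Word q k → WordSet q k → Set
w ∈ˢ M = T (M w)

allWords : (q k : ℕ) → List (Word q k)
allWords q zero = [ [] ]
allWords q (suc k) = concatMap (λ a → map (a ∷_) (allWords q k)) (allFinL q)

card : ∀ {q k} → WordSet q k → ℕ
card {q} {k} M = length (filter (λ w → T? (M w)) (allWords q k))

-- de Bruijn graph D_k on Σ^k, k = suc m: u → v iff the length-m suffix of u
-- equals the length-m prefix of v.
Edge : ∀ {q m} → Word q (suc m) → Word q (suc m) → Set
Edge u v = tail u ≡ init v

EdgeAvoiding : ∀ {q m} → WordSet q (suc m) → Word q (suc m) → Word q (suc m) → Set
EdgeAvoiding M u v = Edge u v × ¬ (u ∈ˢ M) × ¬ (v ∈ˢ M)

Decycling : ∀ {q m} → WordSet q (suc m) → Set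
Decycling {q} {m} M = ∀ (v : Word q (suc m)) → ¬ TransClosure (EdgeAvoiding M) v v

MinimumDecycling : ∀ {q m} → WordSet q (suc m) → Set
MinimumDecycling {q} {m} M =
  Decycling M × (∀ (N : WordSet q (suc m)) → Decycling N → card M ≤ card N)

_≟ʷ_ : ∀ {q k} → DecidableEquality (Word q k)
_≟ʷ_ = ≡-dec _≟ᶠ_

lc : ∀ {q m} → Word q m → WordSet q (suc m)
lc f w = does (tail w ≟ʷ f)

rc : ∀ {q m} → Word q m → WordSet q (suc m)
rc f w = does (init w ≟ʷ f)

_⊆ˢ_ : ∀ {q k} → WordSet q k → WordSet q k → Set
A ⊆ˢ B = ∀ w → w ∈ˢ A → w ∈ˢ B

Fmove : ∀ {q m} → Word q m → WordSet q (suc m) → WordSet q (suc m)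
Fmove f M w = (M w ∧ not (lc f w)) ∨ rc f w

-- An edge u → v of D_k ∖ fM never starts in M: such a u lies in M ∖ fM ⊆ lc(f), so the
-- edge forces v ∈ rc(f) ⊆ fM.  Hence every cycle avoiding fM avoids M, and fM is decycling.
-- For the size, [w ∈ fM] + [w ∈ lc(f)] ≤ [w ∈ M] + [w ∈ rc(f)] for every word w once
-- lc(f) ⊆ M, and |lc(f)| = |rc(f)| = |Σ|, so |fM| ≤ |M|.
module Submission where

open import Defs
open import Data.Nat using (ℕ; suc; _+_; _*_; _≤_; z≤n)
open import Data.Nat.Properties
  using (+-identityʳ; *-identityʳ; *-distribʳ-+; +-mono-≤; +-cancelʳ-≤; ≤-refl; ≤-trans; n≤1+n
        ; +-commutativeSemigroup; module ≤-Reasoning)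
open import Algebra.Properties.CommutativeSemigroup +-commutativeSemigroup using (interchange)
open import Data.Fin using (Fin; zero; suc)
open import Data.Fin.Properties using () renaming (_≟_ to _≟ᶠ_)
open import Data.Bool using (Bool; true; false; _∧_; _∨_; not; T)
open import Data.Bool.Properties using (T?; T-≡; T-∨)
open import Data.Vec using ([]; _∷_; tail; init)
open import Data.List using (List; []; _∷_; _++_; map; concatMap; filter; length; tabulate; allFin)
open import Data.List.Properties using (length-++; filter-++; length-tabulate; map-tabulate)
open import Data.Product using (_,_)
open import Data.Sum using (inj₂)
open import Data.Unit using (tt)
open import Data.Empty using (⊥-elim)
open import Function using (_∘_; id; Equivalence)
open import Relation.Nullary using (¬_; does; yes)
open import Relation.Nullary.Decidable using (dec-true)
open import Relation.Binary.PropositionalEquality using (_≡_; refl; sym; trans; cong; cong₂; module ≡-Reasoning)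
open import Relation.Binary.Construct.Closure.Transitive using (TransClosure; [_]; _∷_)

⟦_⟧ : Bool → ℕ
⟦ true ⟧  = 1
⟦ false ⟧ = 0

count : {A : Set} → (A → Bool) → List A → ℕ
count p xs = length (filter (T? ∘ p) xs)

module _ {A : Set} where

  count-∷ : ∀ (p : A → Bool) x xs → count p (x ∷ xs) ≡ ⟦ p x ⟧ + count p xs
  count-∷ p x xs with p x
  ... | true  = refl
  ... | false = refl

  count-false : ∀ (xs : List A) → count (λ _ → false) xs ≡ 0
  count-false []       = refl
  count-false (_ ∷ xs) = count-false xs

  count-true : ∀ (xs : List A) → count (λ _ → true) xs ≡ length xs
  count-true []       = refl
  count-true (_ ∷ xs) = cong suc (count-true xs)

  count-cong : ∀ {p r : A → Bool} → (∀ x → p x ≡ r x) → ∀ xs → count p xs ≡ count r xs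
  count-cong eq []       = refl
  count-cong {p} {r} eq (x ∷ xs) = begin
    count p (x ∷ xs)         ≡⟨ count-∷ p x xs ⟩
    ⟦ p x ⟧ + count p xs     ≡⟨ cong₂ _+_ (cong ⟦_⟧ (eq x)) (count-cong eq xs) ⟩
    ⟦ r x ⟧ + count r xs     ≡⟨ count-∷ r x xs ⟨
    count r (x ∷ xs)         ∎
    where open ≡-Reasoning

  count-++ : ∀ (p : A → Bool) xs ys → count p (xs ++ ys) ≡ count p xs + count p ys
  count-++ p xs ys = trans (cong length (filter-++ (T? ∘ p) xs ys)) (length-++ (filter (T? ∘ p) xs))

  count-∧ˡ : ∀ c (r : A → Bool) xs → count (λ x → c ∧ r x) xs ≡ ⟦ c ⟧ * count r xs
  count-∧ˡ true  r xs = sym (+-identityʳ (count r xs))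
  count-∧ˡ false r xs = count-false xs

  count-+-mono : ∀ {p r s t : A → Bool} → (∀ x → ⟦ p x ⟧ + ⟦ r x ⟧ ≤ ⟦ s x ⟧ + ⟦ t x ⟧) →
    ∀ xs → count p xs + count r xs ≤ count s xs + count t xs
  count-+-mono pw []       = z≤n
  count-+-mono {p} {r} {s} {t} pw (x ∷ xs) = begin
    count p (x ∷ xs) + count r (x ∷ xs)                   ≡⟨ cong₂ _+_ (count-∷ p x xs) (count-∷ r x xs) ⟩
    (⟦ p x ⟧ + count p xs) + (⟦ r x ⟧ + count r xs)       ≡⟨ interchange ⟦ p x ⟧ (count p xs) ⟦ r x ⟧ (count r xs) ⟩
    (⟦ p x ⟧ + ⟦ r x ⟧) + (count p xs + count r xs)       ≤⟨ +-mono-≤ (pw x) (count-+-mono pw xs) ⟩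
    (⟦ s x ⟧ + ⟦ t x ⟧) + (count s xs + count t xs)       ≡⟨ interchange ⟦ s x ⟧ ⟦ t x ⟧ (count s xs) (count t xs) ⟩
    (⟦ s x ⟧ + count s xs) + (⟦ t x ⟧ + count t xs)       ≡⟨ cong₂ _+_ (count-∷ s x xs) (count-∷ t x xs) ⟨
    count s (x ∷ xs) + count t (x ∷ xs)                   ∎
    where open ≤-Reasoning

count-map : ∀ {A B : Set} (p : A → Bool) (h : B → A) xs → count p (map h xs) ≡ count (p ∘ h) xs
count-map p h []       = refl
count-map p h (x ∷ xs) =
  trans (count-∷ p (h x) (map h xs))
    (trans (cong (⟦ p (h x) ⟧ +_) (count-map p h xs)) (sym (count-∷ (p ∘ h) x xs)))

count-concatMap-map : ∀ {A B C : Set} (_⊗_ : A → B → C) (p : C → Bool) (P : A → Bool) (r : B → Bool) →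
  (∀ a b → p (a ⊗ b) ≡ P a ∧ r b) →
  ∀ xs ys → count p (concatMap (λ a → map (a ⊗_) ys) xs) ≡ count P xs * count r ys
count-concatMap-map _⊗_ p P r split []       ys = refl
count-concatMap-map _⊗_ p P r split (x ∷ xs) ys = begin
  count p (map (x ⊗_) ys ++ rest)                       ≡⟨ count-++ p (map (x ⊗_) ys) rest ⟩
  count p (map (x ⊗_) ys) + count p rest                ≡⟨ cong₂ _+_ head-count (count-concatMap-map _⊗_ p P r split xs ys) ⟩
  ⟦ P x ⟧ * count r ys + count P xs * count r ys        ≡⟨ *-distribʳ-+ (count r ys) ⟦ P x ⟧ (count P xs) ⟨
  (⟦ P x ⟧ + count P xs) * count r ys                   ≡⟨ cong (_* count r ys) (count-∷ P x xs) ⟨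
  count P (x ∷ xs) * count r ys                         ∎
  where
  open ≡-Reasoning
  rest = concatMap (λ a → map (a ⊗_) ys) xs
  head-count : count p (map (x ⊗_) ys) ≡ ⟦ P x ⟧ * count r ys
  head-count = trans (count-map p (x ⊗_) ys) (trans (count-cong (split x) ys) (count-∧ˡ (P x) r ys))

∖∪-indicator : ∀ m l r → (T l → T m) → ⟦ (m ∧ not l) ∨ r ⟧ + ⟦ l ⟧ ≤ ⟦ m ⟧ + ⟦ r ⟧
∖∪-indicator true  true  true  _   = ≤-refl
∖∪-indicator true  true  false _   = ≤-refl
∖∪-indicator true  false true  _   = n≤1+n 1
∖∪-indicator true  false false _   = ≤-refl
∖∪-indicator false true  _     l⇒m = ⊥-elim (l⇒m tt)
∖∪-indicator false false true  _   = ≤-refl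
∖∪-indicator false false false _   = ≤-refl

∖∪-cover : ∀ m l r → T m → ¬ T ((m ∧ not l) ∨ r) → T l
∖∪-cover true true  _ _ _    = tt
∖∪-cover true false _ _ ∉∖∪ = ⊥-elim (∉∖∪ tt)

count-∖∪ : ∀ {A : Set} {M L R : A → Bool} → (∀ x → T (L x) → T (M x)) →
  ∀ xs → count (λ x → (M x ∧ not (L x)) ∨ R x) xs + count L xs ≤ count M xs + count R xs
count-∖∪ {M = M} {L} {R} L⊆M = count-+-mono (λ x → ∖∪-indicator (M x) (L x) (R x) (L⊆M x))

count-tabulate-suc : ∀ {n} (p : Fin (suc n) → Bool) → count p (tabulate suc) ≡ count (p ∘ suc) (allFin n)
count-tabulate-suc p = trans (cong (count p) (sym (map-tabulate id suc))) (count-map p suc (allFin _))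

-- Both clauses rely on does (suc a ≟ᶠ zero) reducing to false and
-- does (suc a ≟ᶠ suc b) to does (a ≟ᶠ b).
count-allFin-≟ : ∀ {n} (b : Fin n) → count (λ a → does (a ≟ᶠ b)) (allFin n) ≡ 1
count-allFin-≟ {suc n} zero    = cong suc (trans (count-tabulate-suc {n} (λ a → does (a ≟ᶠ zero))) (count-false (allFin n)))
count-allFin-≟ {suc n} (suc b) = trans (count-tabulate-suc {n} (λ a → does (a ≟ᶠ suc b))) (count-allFin-≟ b)

count-allFin-true : ∀ n → count (λ _ → true) (allFin n) ≡ n
count-allFin-true n = trans (count-true (allFin n)) (length-tabulate id)

module _ {q : ℕ} where

  count-allWords-∷ : ∀ {n} (p : WordSet q (suc n)) (P : Fin q → Bool) (r : WordSet q n) →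
    (∀ a w → p (a ∷ w) ≡ P a ∧ r w) →
    count p (allWords q (suc n)) ≡ count P (allFin q) * count r (allWords q n)
  count-allWords-∷ {n} p P r split = count-concatMap-map _∷_ p P r split (allFin q) (allWords q n)

  count-≟ʷ : ∀ {m} (f : Word q m) → count (λ w → does (w ≟ʷ f)) (allWords q m) ≡ 1
  count-≟ʷ []      = refl
  count-≟ʷ (b ∷ f) =
    trans (count-allWords-∷ _ (λ a → does (a ≟ᶠ b)) (λ w → does (w ≟ʷ f)) (λ _ _ → refl))
          (cong₂ _*_ (count-allFin-≟ b) (count-≟ʷ f))

  count-lc : ∀ {m} (f : Word q m) → count (lc f) (allWords q (suc m)) ≡ q
  count-lc f =
    trans (count-allWords-∷ (lc f) (λ _ → true) (λ w → does (w ≟ʷ f)) (λ _ _ → refl))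
          (trans (cong₂ _*_ (count-allFin-true q) (count-≟ʷ f)) (*-identityʳ q))

  count-rc : ∀ {m} (f : Word q m) → count (rc f) (allWords q (suc m)) ≡ q
  count-rc []      =
    trans (count-allWords-∷ (rc []) (λ _ → true) (λ _ → true) (λ { _ [] → refl }))
          (trans (cong (_* 1) (count-allFin-true q)) (*-identityʳ q))
  count-rc (b ∷ f) =
    trans (count-allWords-∷ (rc (b ∷ f)) (λ a → does (a ≟ᶠ b)) (rc f) (λ _ _ → refl))
          (trans (cong₂ _*_ (count-allFin-≟ b) (count-rc f)) (+-identityʳ q))

module _ {q m : ℕ} (f : Word q m) (M : WordSet q (suc m)) where

  card-Fmove-≤ : lc f ⊆ˢ M → card (Fmove f M) ≤ card M
  card-Fmove-≤ lc⊆M = +-cancelʳ-≤ (count (lc f) W) (card (Fmove f M)) (card M) (begin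
    card (Fmove f M) + count (lc f) W  ≤⟨ count-∖∪ lc⊆M W ⟩
    card M + count (rc f) W            ≡⟨ cong (card M +_) (trans (count-rc f) (sym (count-lc f))) ⟩
    card M + count (lc f) W            ∎)
    where
    open ≤-Reasoning
    W = allWords q (suc m)

  ∈lc⇒tail≡ : ∀ {w} → w ∈ˢ lc f → tail w ≡ f
  ∈lc⇒tail≡ {w} w∈lc with tail w ≟ʷ f
  ... | yes tail≡f = tail≡f

  init≡⇒∈rc : ∀ {w} → init w ≡ f → w ∈ˢ rc f
  init≡⇒∈rc {w} init≡f = Equivalence.from T-≡ (dec-true (init w ≟ʷ f) init≡f)

  rc⊆Fmove : rc f ⊆ˢ Fmove f M
  rc⊆Fmove _ w∈rc = Equivalence.from T-∨ (inj₂ w∈rc)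

  avoiding-source∉ : ∀ {u v} → EdgeAvoiding (Fmove f M) u v → ¬ u ∈ˢ M
  avoiding-source∉ {u} {v} (u→v , u∉fM , v∉fM) u∈M =
    v∉fM (rc⊆Fmove v (init≡⇒∈rc (trans (sym u→v) (∈lc⇒tail≡ {u} u∈lc))))
    where u∈lc = ∖∪-cover (M u) (lc f u) (rc f u) u∈M u∉fM

  walk-source∉ : ∀ {u w} → TransClosure (EdgeAvoiding (Fmove f M)) u w → ¬ u ∈ˢ M
  walk-source∉ [ e ]   = avoiding-source∉ e
  walk-source∉ (e ∷ _) = avoiding-source∉ e

  walk-lift : ∀ {u w} → TransClosure (EdgeAvoiding (Fmove f M)) u w → ¬ w ∈ˢ M →
    TransClosure (EdgeAvoiding M) u w
  walk-lift [ e@(u→w , _ , _) ] w∉M = [ u→w , avoiding-source∉ e , w∉M ]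
  walk-lift (e@(u→v , _ , _) ∷ p) w∉M = (u→v , avoiding-source∉ e , walk-source∉ p) ∷ walk-lift p w∉M

  Fmove-decycling : Decycling M → Decycling (Fmove f M)
  Fmove-decycling M-decycling v cycle = M-decycling v (walk-lift cycle (walk-source∉ cycle))

proposition2 : (q m : ℕ) → 2 ≤ q → 1 ≤ m →
    (M : WordSet q (suc m)) → MinimumDecycling M →
    (f : Word q m) → lc f ⊆ˢ M →
    MinimumDecycling (Fmove f M)
proposition2 q m _ _ M (M-decycling , M-minimum) f lc⊆M =
  Fmove-decycling f M M-decycling ,
  λ N N-decycling → ≤-trans (card-Fmove-≤ f M lc⊆M) (M-minimum N N-decycling)
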